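{- Let $\mathcal{G}=(V,E,\mathcal{E})$ be an extended graph and let $v\in V$ satisfy $\deg(v)=0$ and $\deg_2(v)=2$ with $N^2(v)=\{u,w\}$, where $u\in N^2[w]$ (i.e. $\{u,w\}\in E\cup\mathcal{E}$). Then $v$ is contained in some maximum 2-packing set of $\mathcal{G}$. Consequently, with $\mathcal{G}'=\mathcal{G}[V\setminus N^2[v]]$, we have $\beta(\mathcal{G})=\beta(\mathcal{G}')+1$.
   Context: Let $H=(V_H,E_H)$ be a finite simple undirected graph and let $\mathcal{E}_H$ be the set of unordered pairs $\{x,y\}$ of distinct vertices with $\{x,y\}\notin E_H$ that have a common neighbor in $H$. An extended graph $\mathcal{G}=(V,E,\mathcal{E})$ is obtained from such an $H$ by choosing $V\subseteq V_H$ and letting $E$ (resp. $\mathcal{E}$) be the pairs of $E_H$ (resp. $\mathcal{E}_H$) with both endpoints in $V$. For $U\subseteq V$, $\mathcal{G}[U]$ denotes the extended graph on $U$ keeping exactly the pairs of $E$ and of $\mathcal{E}$ with both endpoints in $U$. For $v\in V$: $N(v)=\{x:\{x,v\}\in E\}$, $N[v]=N(v)\cup\{v\}$, $\deg(v)=|N(v)|$, $N^2(v)=\{x:\{x,v\}\in\mathcal{E}\}$, $N^2[v]=N^2(v)\cup N[v]$, $\deg_2(v)=|N^2(v)|$. A 2-packing set of $\mathcal{G}$ is a set $S\subseteq V$ such that no two distinct vertices of $S$ form a pair in $E\cup\mathcal{E}$; a maximum 2-packing set is one of maximum cardinality, and $\beta(\mathcal{G})$ is this maximum cardinality. -}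

module Defs where

open import Data.Nat using (ℕ; suc; _≤_)
open import Data.Fin using (Fin; _≟_)
open import Data.Fin.Properties using (any?)
open import Data.Fin.Subset using (Subset; _∈_; _⊆_; ∣_∣)
open import Data.Fin.Subset.Properties using (_∈?_)
open import Data.Vec using (tabulate)
open import Data.Bool using (Bool; _∧_; _∨_; not)
open import Data.Product using (Σ; ∃; _×_; _,_)
open import Data.Sum using (_⊎_)
open import Relation.Nullary using (¬_; Dec; yes; no)
open import Relation.Nullary.Decidable using (⌊_⌋; _×-dec_; _⊎-dec_; ¬?)
open import Relation.Binary using (Decidable)
open import Relation.Binary.PropositionalEquality using (_≡_; _≢_)

record Graph (n : ℕ) : Set₁ where
  field
    Adj    : Fin n → Fin n → Set
    adj?   : Decidable Adj
    sym    : ∀ {x y} → Adj x y → Adj y x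
    irrefl : ∀ {x} → ¬ Adj x x
open Graph public

Ext : ∀ {n} → Graph n → Fin n → Fin n → Set
Ext H x y = (x ≢ y) × (¬ Adj H x y) × ∃ λ z → Adj H x z × Adj H z y

ext? : ∀ {n} (H : Graph n) → Decidable (Ext H)
ext? H x y = ¬? (x ≟ y) ×-dec (¬? (adj? H x y) ×-dec
             any? (λ z → adj? H x z ×-dec adj? H z y))

Near : ∀ {n} → Graph n → Fin n → Fin n → Set
Near H x y = Adj H x y ⊎ Ext H x y

near? : ∀ {n} (H : Graph n) → Decidable (Near H)
near? H x y = adj? H x y ⊎-dec ext? H x y

-- An extended graph: the ambient graph H together with the chosen vertex set V ⊆ V_H.
-- Its E and 𝓔 are the pairs of E_H and 𝓔_H with both endpoints in V; the induced
-- extended graph 𝒢[U] is therefore obtained by replacing V by U.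
record ExtGraph (n : ℕ) : Set₁ where
  constructor mkExt
  field
    H : Graph n
    V : Subset n
open ExtGraph public

induced : ∀ {n} → ExtGraph n → Subset n → ExtGraph n
induced G U = mkExt (H G) U

Is2Packing : ∀ {n} → ExtGraph n → Subset n → Set
Is2Packing G S = S ⊆ V G × (∀ {x y} → x ∈ S → y ∈ S → x ≢ y → ¬ Near (H G) x y)

IsMax2Packing : ∀ {n} → ExtGraph n → Subset n → Set
IsMax2Packing G S = Is2Packing G S × (∀ T → Is2Packing G T → ∣ T ∣ ≤ ∣ S ∣)

VminusN2closed : ∀ {n} → ExtGraph n → Fin n → Subset n
VminusN2closed G v =
  tabulate λ x → ⌊ x ∈? V G ⌋ ∧ not (⌊ x ≟ v ⌋ ∨ ⌊ near? (H G) x v ⌋)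

-- Let U = V ∖ N²[v].  Adding v to a 2-packing of 𝒢[U] gives a 2-packing of 𝒢, because v is
-- near nothing in U.  Conversely, a 2-packing of 𝒢 lies in U except for vertices of N²[v],
-- which here is the triangle {v, u, w}; a 2-packing meets a triangle at most once, so
-- |S| ≤ 1 + |S ∩ U|.  Hence β(𝒢) = β(𝒢[U]) + 1, and replacing the part of a maximum
-- 2-packing outside U by v keeps it maximum.
module Submission where

open import Defs
open import Data.Nat using (zero; suc; _+_; _≤_; _<_; z≤n; s≤s)
open import Data.Nat.Properties
  using (≤-trans; ≤-reflexive; ≤-antisym; +-comm; +-suc; +-monoʳ-≤; m≤m+n; _<?_; <⇒≱; ≮⇒≥; module ≤-Reasoning)
open import Data.Fin using (Fin; zero; suc; _≟_)
open import Data.Fin.Properties using (all?)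
open import Data.Fin.Subset using (Subset; _∈_; _∉_; _⊆_; ∣_∣; _∪_; _∩_; ⁅_⁆; inside; outside)
  renaming (⊥ to ∅)
open import Data.Fin.Subset.Properties
  using (_∈?_; _⊆?_; anySubset?; ∉⊥; x∈⁅x⁆; x∈⁅y⁆⇒x≡y; ∣⁅x⁆∣≡1; ∣p∣≤n; ∣p∣≤∣x∷p∣; ∣p∣≤∣p∪q∣;
         p⊆q⇒∣p∣≤∣q∣; x∈p∪q⁺; x∈p∪q⁻; x∈p∩q⁺; x∈p∩q⁻)
open import Data.Vec using ([]; _∷_; tabulate; here; there)
open import Data.Vec.Properties using (lookup∘tabulate; lookup⇒[]=; []=⇒lookup)
open import Data.Bool using (Bool; true; _∧_; _∨_; not)
open import Data.Product using (Σ; _×_; _,_; proj₁; proj₂)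
open import Data.Sum using (_⊎_; inj₁; inj₂)
open import Function using (const)
open import Function.Bundles using (_⇔_; mk⇔; Equivalence)
import Function.Properties.Equivalence as ⇔
open import Relation.Nullary using (¬_; Dec; yes; no; contradiction)
open import Relation.Nullary.Decidable using (⌊_⌋; map′; _×-dec_; _→-dec_; ¬?)
open import Relation.Unary using (Pred) renaming (Decidable to Decidable₁)
open import Relation.Binary.PropositionalEquality using (_≡_; _≢_; refl; trans; cong) renaming (sym to ≡-sym)

∣p∪q∣≤∣p∣+∣q∣ : ∀ {n} (p q : Subset n) → ∣ p ∪ q ∣ ≤ ∣ p ∣ + ∣ q ∣
∣p∪q∣≤∣p∣+∣q∣ []            []            = z≤n
∣p∪q∣≤∣p∣+∣q∣ (inside  ∷ p) (t       ∷ q) =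
  s≤s (≤-trans (∣p∪q∣≤∣p∣+∣q∣ p q) (+-monoʳ-≤ ∣ p ∣ (∣p∣≤∣x∷p∣ t q)))
∣p∪q∣≤∣p∣+∣q∣ (outside ∷ p) (inside  ∷ q) =
  ≤-trans (s≤s (∣p∪q∣≤∣p∣+∣q∣ p q)) (≤-reflexive (≡-sym (+-suc ∣ p ∣ ∣ q ∣)))
∣p∪q∣≤∣p∣+∣q∣ (outside ∷ p) (outside ∷ q) = ∣p∪q∣≤∣p∣+∣q∣ p q

p⊆q∪⁅x⁆⇒∣p∣≤1+∣q∣ : ∀ {n} {p q : Subset n} {x} → p ⊆ q ∪ ⁅ x ⁆ → ∣ p ∣ ≤ suc ∣ q ∣
p⊆q∪⁅x⁆⇒∣p∣≤1+∣q∣ {p = p} {q} {x} p⊆q∪x = begin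
  ∣ p ∣                ≤⟨ p⊆q⇒∣p∣≤∣q∣ p⊆q∪x ⟩
  ∣ q ∪ ⁅ x ⁆ ∣        ≤⟨ ∣p∪q∣≤∣p∣+∣q∣ q ⁅ x ⁆ ⟩
  ∣ q ∣ + ∣ ⁅ x ⁆ ∣    ≡⟨ cong (∣ q ∣ +_) (∣⁅x⁆∣≡1 x) ⟩
  ∣ q ∣ + 1            ≡⟨ +-comm ∣ q ∣ 1 ⟩
  suc ∣ q ∣            ∎
  where open ≤-Reasoning

x∉p⇒∣p∣<∣p∪⁅x⁆∣ : ∀ {n} {x : Fin n} {p : Subset n} → x ∉ p → ∣ p ∣ < ∣ p ∪ ⁅ x ⁆ ∣
x∉p⇒∣p∣<∣p∪⁅x⁆∣ {x = zero}  {inside  ∷ p} x∉p = contradiction here x∉p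
x∉p⇒∣p∣<∣p∪⁅x⁆∣ {x = zero}  {outside ∷ p} _   = s≤s (∣p∣≤∣p∪q∣ p ∅)
x∉p⇒∣p∣<∣p∪⁅x⁆∣ {x = suc x} {inside  ∷ p} x∉p = s≤s (x∉p⇒∣p∣<∣p∪⁅x⁆∣ (λ x∈p → x∉p (there x∈p)))
x∉p⇒∣p∣<∣p∪⁅x⁆∣ {x = suc x} {outside ∷ p} x∉p = x∉p⇒∣p∣<∣p∪⁅x⁆∣ (λ x∈p → x∉p (there x∈p))

∈-tabulate⇔ : ∀ {n} (f : Fin n → Bool) x → x ∈ tabulate f ⇔ f x ≡ true
∈-tabulate⇔ f x = mk⇔
  (λ x∈f → trans (≡-sym (lookup∘tabulate f x)) ([]=⇒lookup x∈f))
  (λ fx → lookup⇒[]= x (tabulate f) (trans (lookup∘tabulate f x) fx))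

∧-not-∨-≡true⇔ : ∀ {a b c} {A : Set a} {B : Set b} {C : Set c} (A? : Dec A) (B? : Dec B) (C? : Dec C) →
                 (⌊ A? ⌋ ∧ not (⌊ B? ⌋ ∨ ⌊ C? ⌋)) ≡ true ⇔ (A × ¬ B × ¬ C)
∧-not-∨-≡true⇔ (yes a)  (no ¬b) (no ¬c) = mk⇔ (const (a , ¬b , ¬c)) (const refl)
∧-not-∨-≡true⇔ (no ¬a)  _       _       = mk⇔ (λ ()) (λ (a , _) → contradiction a ¬a)
∧-not-∨-≡true⇔ (yes _)  (yes b) _       = mk⇔ (λ ()) (λ (_ , ¬b , _) → contradiction b ¬b)
∧-not-∨-≡true⇔ (yes _)  (no _)  (yes c) = mk⇔ (λ ()) (λ (_ , _ , ¬c) → contradiction c ¬c)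

module _ {n} {ℓ} {P : Pred (Subset n) ℓ} (P? : Decidable₁ P) where

  ∃-largest : ∀ {p} → P p → Σ (Subset n) λ S → P S × (∀ T → P T → ∣ T ∣ ≤ ∣ S ∣)
  ∃-largest {p} Pp = climb n p Pp (m≤m+n n ∣ p ∣)
    where
    -- Each step strictly enlarges ∣ S ∣ ≤ n, so the fuel k never runs out.
    climb : ∀ k S → P S → n ≤ k + ∣ S ∣ → Σ (Subset n) λ M → P M × (∀ T → P T → ∣ T ∣ ≤ ∣ M ∣)
    climb k S PS n≤k+∣S∣ with anySubset? (λ T → P? T ×-dec ∣ S ∣ <? ∣ T ∣)
    ... | no ∄larger = S , PS , λ T PT → ≮⇒≥ (λ ∣S∣<∣T∣ → ∄larger (T , PT , ∣S∣<∣T∣))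
    climb zero    S PS n≤∣S∣     | yes (T , _ , ∣S∣<∣T∣) = contradiction (≤-trans (∣p∣≤n T) n≤∣S∣) (<⇒≱ ∣S∣<∣T∣)
    climb (suc k) S PS n≤k+1+∣S∣ | yes (T , PT , ∣S∣<∣T∣) =
      climb k T PT (≤-trans n≤k+1+∣S∣ (≤-trans (≤-reflexive (≡-sym (+-suc k ∣ S ∣))) (+-monoʳ-≤ k ∣S∣<∣T∣)))

Near-sym : ∀ {n} (H : Graph n) {x y} → Near H x y → Near H y x
Near-sym H (inj₁ xy) = inj₁ (Graph.sym H xy)
Near-sym H (inj₂ (x≢y , ¬xy , z , xz , zy)) =
  inj₂ ((λ y≡x → x≢y (≡-sym y≡x)) , (λ yx → ¬xy (Graph.sym H yx)) , z , Graph.sym H zy , Graph.sym H xz)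

Near⇒≢ : ∀ {n} (H : Graph n) {x y} → Near H x y → x ≢ y
Near⇒≢ H (inj₁ xx) refl = irrefl H xx
Near⇒≢ H (inj₂ (x≢y , _)) = x≢y

module _ {n} (G : ExtGraph n) where

  Is2Packing⇒¬Near : ∀ {S x y} → Is2Packing G S → x ∈ S → y ∈ S → ¬ Near (H G) x y
  Is2Packing⇒¬Near (_ , sep) x∈S y∈S xy = sep x∈S y∈S (Near⇒≢ (H G) xy) xy

  Is2Packing? : Decidable₁ (Is2Packing G)
  Is2Packing? S = (S ⊆? V G) ×-dec
    map′ (λ sep {x} {y} → sep x y) (λ sep x y → sep {x} {y})
      (all? λ x → all? λ y →
        (x ∈? S) →-dec (y ∈? S) →-dec ¬? (x ≟ y) →-dec ¬? (near? (H G) x y))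

  ∅-Is2Packing : Is2Packing G ∅
  ∅-Is2Packing = (λ x∈∅ → contradiction x∈∅ ∉⊥) , (λ x∈∅ → contradiction x∈∅ ∉⊥)

  ∃-maximum-2-packing : Σ (Subset n) (IsMax2Packing G)
  ∃-maximum-2-packing = ∃-largest Is2Packing? ∅-Is2Packing

  ∩-Is2Packing-induced : ∀ {S} U → Is2Packing G S → Is2Packing (induced G U) (S ∩ U)
  ∩-Is2Packing-induced {S} U (_ , sep) =
    (λ x∈S∩U → proj₂ (x∈p∩q⁻ S U x∈S∩U)) ,
    (λ x∈S∩U y∈S∩U → sep (proj₁ (x∈p∩q⁻ S U x∈S∩U)) (proj₁ (x∈p∩q⁻ S U y∈S∩U)))

  Is2Packing-meets-triangle : ∀ {S a b c} → Is2Packing G S →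
    Near (H G) a b → Near (H G) a c → Near (H G) b c →
    Σ (Fin n) λ z → ∀ {x} → x ∈ S → x ≡ a ⊎ x ≡ b ⊎ x ≡ c → x ≡ z
  Is2Packing-meets-triangle {S} {a} {b} {c} pS ab ac bc with a ∈? S | b ∈? S
  ... | yes a∈S | _ = a , λ where
    _   (inj₁ refl)        → refl
    b∈S (inj₂ (inj₁ refl)) → contradiction ab (Is2Packing⇒¬Near pS a∈S b∈S)
    c∈S (inj₂ (inj₂ refl)) → contradiction ac (Is2Packing⇒¬Near pS a∈S c∈S)
  ... | no a∉S | yes b∈S = b , λ where
    a∈S (inj₁ refl)        → contradiction a∈S a∉S
    _   (inj₂ (inj₁ refl)) → refl
    c∈S (inj₂ (inj₂ refl)) → contradiction bc (Is2Packing⇒¬Near pS b∈S c∈S)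
  ... | no a∉S | no b∉S = c , λ where
    a∈S (inj₁ refl)        → contradiction a∈S a∉S
    b∈S (inj₂ (inj₁ refl)) → contradiction b∈S b∉S
    _   (inj₂ (inj₂ refl)) → refl

module _ {n} (G : ExtGraph n) (v : Fin n) where

  ∈VminusN2closed⇔ : ∀ {x} → x ∈ VminusN2closed G v ⇔ (x ∈ V G × x ≢ v × ¬ Near (H G) x v)
  ∈VminusN2closed⇔ {x} =
    ⇔.trans (∈-tabulate⇔ _ x) (∧-not-∨-≡true⇔ (x ∈? V G) (x ≟ v) (near? (H G) x v))

  v∉VminusN2closed : v ∉ VminusN2closed G v
  v∉VminusN2closed v∈U = proj₁ (proj₂ (Equivalence.to ∈VminusN2closed⇔ v∈U)) refl

  ∉VminusN2closed : ∀ {x} → x ∈ V G → x ∉ VminusN2closed G v → x ≡ v ⊎ Near (H G) x v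
  ∉VminusN2closed {x} x∈V x∉U with x ≟ v | near? (H G) x v
  ... | yes x≡v | _      = inj₁ x≡v
  ... | no _    | yes xv = inj₂ xv
  ... | no x≢v  | no ¬xv = contradiction (Equivalence.from ∈VminusN2closed⇔ (x∈V , x≢v , ¬xv)) x∉U

  ∪⁅v⁆-Is2Packing : v ∈ V G → ∀ {T} → Is2Packing (induced G (VminusN2closed G v)) T →
                    Is2Packing G (T ∪ ⁅ v ⁆)
  ∪⁅v⁆-Is2Packing v∈V {T} (T⊆U , sep) = T∪v⊆V , T∪v-sep
    where
    far-from-v : ∀ {x} → x ∈ T → x ∈ V G × ¬ Near (H G) x v
    far-from-v x∈T with Equivalence.to ∈VminusN2closed⇔ (T⊆U x∈T)
    ... | x∈V , _ , ¬xv = x∈V , ¬xv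

    T∪v⊆V : T ∪ ⁅ v ⁆ ⊆ V G
    T∪v⊆V x∈T∪v with x∈p∪q⁻ T ⁅ v ⁆ x∈T∪v
    ... | inj₁ x∈T = proj₁ (far-from-v x∈T)
    ... | inj₂ x∈v rewrite x∈⁅y⁆⇒x≡y v x∈v = v∈V

    T∪v-sep : ∀ {x y} → x ∈ T ∪ ⁅ v ⁆ → y ∈ T ∪ ⁅ v ⁆ → x ≢ y → ¬ Near (H G) x y
    T∪v-sep x∈T∪v y∈T∪v x≢y with x∈p∪q⁻ T ⁅ v ⁆ x∈T∪v | x∈p∪q⁻ T ⁅ v ⁆ y∈T∪v
    ... | inj₁ x∈T | inj₁ y∈T = sep x∈T y∈T x≢y
    ... | inj₁ x∈T | inj₂ y∈v rewrite x∈⁅y⁆⇒x≡y v y∈v = proj₂ (far-from-v x∈T)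
    ... | inj₂ x∈v | inj₁ y∈T rewrite x∈⁅y⁆⇒x≡y v x∈v = λ vy → proj₂ (far-from-v y∈T) (Near-sym (H G) vy)
    ... | inj₂ x∈v | inj₂ y∈v = contradiction (trans (x∈⁅y⁆⇒x≡y v x∈v) (≡-sym (x∈⁅y⁆⇒x≡y v y∈v))) x≢y

  Is2Packing⇒∣S∣≤1+∣S∩VminusN2closed∣ : ∀ {u w} →
    (∀ x → x ∈ V G → Near (H G) x v → x ≡ u ⊎ x ≡ w) →
    Near (H G) v u → Near (H G) v w → Near (H G) u w →
    ∀ {S} → Is2Packing G S → ∣ S ∣ ≤ suc ∣ S ∩ VminusN2closed G v ∣
  Is2Packing⇒∣S∣≤1+∣S∩VminusN2closed∣ {u} {w} N²v vu vw uw {S} pS =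
    let z , only-z = Is2Packing-meets-triangle G pS vu vw uw
    in  p⊆q∪⁅x⁆⇒∣p∣≤1+∣q∣ (S⊆S∩U∪⁅ only-z ⁆)
    where
    U : Subset n
    U = VminusN2closed G v

    outside-U : ∀ {x} → x ∈ S → x ∉ U → x ≡ v ⊎ x ≡ u ⊎ x ≡ w
    outside-U x∈S x∉U with ∉VminusN2closed (proj₁ pS x∈S) x∉U
    ... | inj₁ x≡v = inj₁ x≡v
    ... | inj₂ xv  = inj₂ (N²v _ (proj₁ pS x∈S) xv)

    S⊆S∩U∪⁅_⁆ : ∀ {z} → (∀ {x} → x ∈ S → x ≡ v ⊎ x ≡ u ⊎ x ≡ w → x ≡ z) → S ⊆ (S ∩ U) ∪ ⁅ z ⁆
    S⊆S∩U∪⁅ only-z ⁆ {x} x∈S with x ∈? U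
    ... | yes x∈U = x∈p∪q⁺ (inj₁ (x∈p∩q⁺ (x∈S , x∈U)))
    ... | no x∉U rewrite only-z x∈S (outside-U x∈S x∉U) = x∈p∪q⁺ (inj₂ (x∈⁅x⁆ _))

mainTheorem5 : ∀ {n} (G : ExtGraph n) (v u w : Fin n) →
    v ∈ V G →
    (∀ x → x ∈ V G → ¬ Adj (H G) x v) →
    u ∈ V G → w ∈ V G → u ≢ w →
    Ext (H G) u v → Ext (H G) w v →
    (∀ x → x ∈ V G → Ext (H G) x v → x ≡ u ⊎ x ≡ w) →
    Near (H G) u w →
    (Σ (Subset n) λ S → IsMax2Packing G S × v ∈ S)
    × (∀ S S′ → IsMax2Packing G S →
         IsMax2Packing (induced G (VminusN2closed G v)) S′ →
         ∣ S ∣ ≡ suc ∣ S′ ∣)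
mainTheorem5 {n} G v u w v∈V ¬adj _ _ _ uv wv N²v⊆ uw with ∃-maximum-2-packing G
... | S₀ , S₀-packing , S₀-largest =
  (S₁ , (∪⁅v⁆-Is2Packing G v v∈V S₀∩U-packing , S₁-largest) , x∈p∪q⁺ (inj₂ (x∈⁅x⁆ v))) , β≡1+β′
  where
  U : Subset n
  U = VminusN2closed G v

  near-v : ∀ x → x ∈ V G → Near (H G) x v → x ≡ u ⊎ x ≡ w
  near-v x x∈V (inj₁ xv) = contradiction xv (¬adj x x∈V)
  near-v x x∈V (inj₂ xv) = N²v⊆ x x∈V xv

  shrink : ∀ {S} → Is2Packing G S → ∣ S ∣ ≤ suc ∣ S ∩ U ∣
  shrink = Is2Packing⇒∣S∣≤1+∣S∩VminusN2closed∣ G v near-v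
             (Near-sym (H G) (inj₂ uv)) (Near-sym (H G) (inj₂ wv)) uw

  grow : ∀ {T} → Is2Packing (induced G U) T → suc ∣ T ∣ ≤ ∣ T ∪ ⁅ v ⁆ ∣
  grow (T⊆U , _) = x∉p⇒∣p∣<∣p∪⁅x⁆∣ (λ v∈T → v∉VminusN2closed G v (T⊆U v∈T))

  S₀∩U-packing : Is2Packing (induced G U) (S₀ ∩ U)
  S₀∩U-packing = ∩-Is2Packing-induced G U S₀-packing

  S₁ : Subset n
  S₁ = (S₀ ∩ U) ∪ ⁅ v ⁆

  S₁-largest : ∀ T → Is2Packing G T → ∣ T ∣ ≤ ∣ S₁ ∣
  S₁-largest T pT = ≤-trans (S₀-largest T pT)
                      (≤-trans (shrink S₀-packing) (grow S₀∩U-packing))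

  β≡1+β′ : ∀ S S′ → IsMax2Packing G S → IsMax2Packing (induced G U) S′ → ∣ S ∣ ≡ suc ∣ S′ ∣
  β≡1+β′ S S′ (pS , S-largest) (pS′ , S′-largest) = ≤-antisym
    (≤-trans (shrink pS) (s≤s (S′-largest (S ∩ U) (∩-Is2Packing-induced G U pS))))
    (≤-trans (grow pS′) (S-largest (S′ ∪ ⁅ v ⁆) (∪⁅v⁆-Is2Packing G v v∈V pS′)))
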